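{- With $\mathcal{A}$, $\mathcal{A}'$ and $\Phi:\mathcal{A}\to\mathcal{A}'$, $\Phi(A)=\{x\in\mathbb{Z}^{(\mathbb{N})}:\ \prod_{n\in\mathbb{N}}n^{x(n)}=1 \text{ in } \widetilde A\}$, as in the context, the set $\Phi(\mathcal{A})$ is nowhere dense in $\mathcal{A}'$.
   Context: $\mathbb{N}=\{1,2,3,\dots\}$. $\mathcal{G}\subseteq\mathbb{N}^{\mathbb{N}\times\mathbb{N}}$ (product of discrete spaces) is the subspace of those $A$ such that $(i,j)\mapsto A(i,j)$ is the multiplication of a group on $\mathbb{N}$ with identity $1$; for $A\in\mathcal{G}$, $\widetilde A$ is that group (written multiplicatively). $\mathcal{A}=\{A\in\mathcal{G}:\widetilde A\text{ abelian}\}$. $\mathbb{Z}^{(\mathbb{N})}$ is the group of finitely supported functions $\mathbb{N}\to\mathbb{Z}$; $\mathcal{A}'$ is the set of its subgroups with the subspace topology inherited from the Cantor space $2^{\mathbb{Z}^{(\mathbb{N})}}$. -}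

module Defs where

open import Data.Nat using (ℕ; zero; suc; _≤_; _⊔_; _≟_)
open import Data.Nat.Properties using (m⊔n≤o⇒m≤o; m⊔n≤o⇒n≤o)
open import Data.Integer as ℤ using (ℤ; +_; -[1+_]; 0ℤ)
open import Data.Bool using (Bool; true; false)
open import Data.List using (List)
open import Data.List.Relation.Unary.All using (All)
open import Data.Product using (Σ; _×_; _,_; proj₁; proj₂)
open import Relation.Nullary using (¬_)
open import Relation.Nullary.Decidable using (⌊_⌋)
open import Relation.Binary.PropositionalEquality using (_≡_; cong; cong₂)

-- CONVENTION: the paper's ℕ = {1,2,3,...}.  We encode the positive integer
-- k+1 by the Agda natural k.  So the group identity 1 is coded by 0, and a
-- coordinate x(k+1) of an element of ℤ^(ℕ) is stored at index k.

record IsAbGroupTable (A : ℕ → ℕ → ℕ) : Set where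
  field
    assoc  : ∀ a b c → A (A a b) c ≡ A a (A b c)
    idˡ    : ∀ a → A 0 a ≡ a
    idʳ    : ∀ a → A a 0 ≡ a
    inv    : ℕ → ℕ
    invˡ   : ∀ a → A (inv a) a ≡ 0
    invʳ   : ∀ a → A a (inv a) ≡ 0
    comm   : ∀ a b → A a b ≡ A b a

record ZN : Set where
  constructor mkZN
  field
    fun   : ℕ → ℤ
    bound : ℕ
    supp  : ∀ n → bound ≤ n → fun n ≡ 0ℤ
open ZN public

_≈Z_ : ZN → ZN → Set
x ≈Z y = ∀ n → fun x n ≡ fun y n

zeroZ : ZN
zeroZ = mkZN (λ _ → 0ℤ) 0 (λ _ _ → _≡_.refl)

_+Z_ : ZN → ZN → ZN
x +Z y = mkZN (λ n → fun x n ℤ.+ fun y n) (bound x ⊔ bound y)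
  (λ n p → cong₂ ℤ._+_ (supp x n (m⊔n≤o⇒m≤o (bound x) (bound y) p))
                        (supp y n (m⊔n≤o⇒n≤o (bound x) (bound y) p)))

-Z_ : ZN → ZN
-Z x = mkZN (λ n → ℤ.- fun x n) (bound x)
  (λ n p → cong ℤ.-_ (supp x n p))

-- A point of 2^(ℤ^(ℕ)) is a Bool-valued function on ℤ^(ℕ) which is
-- well defined on ℤ^(ℕ) (respects pointwise equality).
record IsSubgroup (S : ZN → Bool) : Set where
  field
    resp  : ∀ x y → x ≈Z y → S x ≡ S y
    has0  : S zeroZ ≡ true
    has+  : ∀ x y → S x ≡ true → S y ≡ true → S (x +Z y) ≡ true
    has-  : ∀ x → S x ≡ true → S (-Z x) ≡ true

-- Basic open sets of the Cantor space: finitely many prescribed values.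
BasicOpen : Set
BasicOpen = List (ZN × Bool)

_∈O_ : (ZN → Bool) → BasicOpen → Set
S ∈O U = All (λ p → S (proj₁ p) ≡ proj₂ p) U

module _ (A : ℕ → ℕ → ℕ) (G : IsAbGroupTable A) where
  open IsAbGroupTable G

  powℕ : ℕ → ℕ → ℕ
  powℕ g zero    = 0
  powℕ g (suc k) = A g (powℕ g k)

  powℤ : ℕ → ℤ → ℕ
  powℤ g (+ k)     = powℕ g k
  powℤ g -[1+ k ]  = powℕ (inv g) (suc k)

  -- ∏_{n < b} (n+1)^{f n}   (codes as above)
  prodUpTo : (ℕ → ℤ) → ℕ → ℕ
  prodUpTo f zero    = 0
  prodUpTo f (suc b) = A (prodUpTo f b) (powℤ b (f b))

  -- ∏_{n ∈ ℕ} n^{x(n)} ; all factors beyond the bound are the identity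
  prodZN : ZN → ℕ
  prodZN x = prodUpTo (fun x) (bound x)

  Φ : ZN → Bool
  Φ x = ⌊ prodZN x ≟ 0 ⌋

-- Nowhere density of Φ(𝒜) in the subspace 𝒜' of the Cantor space:
-- every nonempty (basic) open subset U ∩ 𝒜' of 𝒜' contains a nonempty
-- (basic) open subset V ∩ 𝒜' of 𝒜' which is disjoint from Φ(𝒜).

NowhereDenseΦ : Set
NowhereDenseΦ =
  (U : BasicOpen) →
  Σ (ZN → Bool) (λ S → IsSubgroup S × S ∈O U) →
  Σ BasicOpen λ V →
      Σ (ZN → Bool) (λ S → IsSubgroup S × S ∈O V)
    × (∀ (S : ZN → Bool) → IsSubgroup S → S ∈O V → S ∈O U)
    × (∀ (A : ℕ → ℕ → ℕ) (G : IsAbGroupTable A) → ¬ (Φ A G ∈O V))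

-- A basic open set fixes finitely many coordinates of a subgroup S, all of them
-- supported below some B.  Replacing S by the subgroup of all x whose truncation
-- to the coordinates below B lies in S keeps those coordinates and adds the
-- element e_{B+1} − e_{B+2}, whose truncation vanishes.  So "e_{B+1} − e_{B+2} ∈ S"
-- cuts out a nonempty open subset of U ∩ 𝒜', and it misses Φ(𝒜) because
-- e_{B+1} − e_{B+2} ∈ Φ(A) would force (B+1)(B+2)⁻¹ = 1 in Ã.
module Submission where

open import Defs
open import Level using (0ℓ)
open import Algebra.Bundles using (Group)
import Algebra.Properties.Group as GroupProperties
open import Data.Bool using (Bool; true; false; if_then_else_)
open import Data.List using ([]; _∷_)
open import Data.List.Relation.Unary.All using ([]; _∷_)
open import Data.Integer using (ℤ; +_; -[1+_]; 0ℤ)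
open import Data.Nat using (ℕ; zero; suc; _≤_; _<_; _⊔_; _<ᵇ_; _≟_; s≤s)
open import Data.Nat.Properties
  using (≤-refl; ≤-trans; n≤1+n; n<1+n; <⇒≢; <⇒≱; ≮⇒≥; <ᵇ-reflects-<; m⊔n≤o⇒m≤o; m⊔n≤o⇒n≤o)
open import Data.Product using (_,_; proj₁)
open import Function using (_∘_)
open import Relation.Nullary.Decidable using (isYes≗does; dec-false)
open import Relation.Nullary.Negation using (¬_; contradiction)
open import Relation.Nullary.Reflects using (ofʸ; ofⁿ)
open import Relation.Binary.PropositionalEquality
  using (_≡_; refl; sym; trans; cong; cong₂; isEquivalence)

truncate : ℕ → ZN → ZN
truncate B x = mkZN (λ n → if n <ᵇ B then fun x n else 0ℤ) B vanishes
  where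
  vanishes : ∀ n → B ≤ n → (if n <ᵇ B then fun x n else 0ℤ) ≡ 0ℤ
  vanishes n B≤n with n <ᵇ B | <ᵇ-reflects-< n B
  ... | true  | ofʸ n<B = contradiction B≤n (<⇒≱ n<B)
  ... | false | _       = refl

truncate-cong : ∀ B x y → x ≈Z y → truncate B x ≈Z truncate B y
truncate-cong B x y x≈y n with n <ᵇ B
... | true  = x≈y n
... | false = refl

truncate-zero : ∀ B → truncate B zeroZ ≈Z zeroZ
truncate-zero B n with n <ᵇ B
... | true  = refl
... | false = refl

truncate-+ : ∀ B x y → truncate B (x +Z y) ≈Z (truncate B x +Z truncate B y)
truncate-+ B x y n with n <ᵇ B
... | true  = refl
... | false = refl

truncate-neg : ∀ B x → truncate B (-Z x) ≈Z (-Z truncate B x)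
truncate-neg B x n with n <ᵇ B
... | true  = refl
... | false = refl

truncate-id : ∀ {B} x → bound x ≤ B → truncate B x ≈Z x
truncate-id {B} x bx≤B n with n <ᵇ B | <ᵇ-reflects-< n B
... | true  | _       = refl
... | false | ofⁿ n≮B = sym (supp x n (≤-trans bx≤B (≮⇒≥ n≮B)))

truncatePreimage : ℕ → (ZN → Bool) → ZN → Bool
truncatePreimage B S x = S (truncate B x)

module _ {S : ZN → Bool} (S-subgroup : IsSubgroup S) (B : ℕ) where
  open IsSubgroup S-subgroup

  truncatePreimage-isSubgroup : IsSubgroup (truncatePreimage B S)
  truncatePreimage-isSubgroup = record
    { resp = λ x y x≈y → resp _ _ (truncate-cong B x y x≈y)
    ; has0 = trans (resp _ _ (truncate-zero B)) has0
    ; has+ = λ x y x∈ y∈ → trans (resp _ _ (truncate-+ B x y)) (has+ _ _ x∈ y∈)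
    ; has- = λ x x∈ → trans (resp _ _ (truncate-neg B x)) (has- _ x∈)
    }

  truncatePreimage-agrees : ∀ x → bound x ≤ B → truncatePreimage B S x ≡ S x
  truncatePreimage-agrees x bx≤B = resp _ _ (truncate-id x bx≤B)

boundO : BasicOpen → ℕ
boundO []      = 0
boundO (p ∷ U) = bound (proj₁ p) ⊔ boundO U

∈O-truncatePreimage : ∀ {S} (S-subgroup : IsSubgroup S) {B} U → boundO U ≤ B →
                      S ∈O U → truncatePreimage B S ∈O U
∈O-truncatePreimage S-subgroup []      _  []         = []
∈O-truncatePreimage S-subgroup (p ∷ U) U≤B (Sp ∷ S∈U) =
  trans (truncatePreimage-agrees S-subgroup _ (proj₁ p) (m⊔n≤o⇒m≤o _ _ U≤B)) Sp
  ∷ ∈O-truncatePreimage S-subgroup U (m⊔n≤o⇒n≤o _ _ U≤B) S∈U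

-- The coordinates of e_{k+1} − e_{k+2}: +1 at code k, −1 at code k+1.
unitDifference : ℕ → ℕ → ℤ
unitDifference zero    zero          = + 1
unitDifference zero    (suc zero)    = -[1+ 0 ]
unitDifference zero    (suc (suc _)) = 0ℤ
unitDifference (suc k) zero          = 0ℤ
unitDifference (suc k) (suc n)       = unitDifference k n

unitDifference-below : ∀ k n → n < k → unitDifference k n ≡ 0ℤ
unitDifference-below (suc k) zero    _         = refl
unitDifference-below (suc k) (suc n) (s≤s n<k) = unitDifference-below k n n<k

unitDifference-above : ∀ k n → suc (suc k) ≤ n → unitDifference k n ≡ 0ℤ
unitDifference-above zero    zero          ()
unitDifference-above zero    (suc zero)    (s≤s ())
unitDifference-above zero    (suc (suc n)) _          = refl
unitDifference-above (suc k) (suc n)       (s≤s k≤n) = unitDifference-above k n k≤n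

unitDifference-at : ∀ k → unitDifference k k ≡ + 1
unitDifference-at zero    = refl
unitDifference-at (suc k) = unitDifference-at k

unitDifference-next : ∀ k → unitDifference k (suc k) ≡ -[1+ 0 ]
unitDifference-next zero    = refl
unitDifference-next (suc k) = unitDifference-next k

e₋e : ℕ → ZN
e₋e k = mkZN (unitDifference k) (suc (suc k)) (unitDifference-above k)

truncate-e₋e : ∀ k → truncate k (e₋e k) ≈Z zeroZ
truncate-e₋e k n with n <ᵇ k | <ᵇ-reflects-< n k
... | true  | ofʸ n<k = unitDifference-below k n n<k
... | false | _       = refl

module _ (A : ℕ → ℕ → ℕ) (G : IsAbGroupTable A) where
  open IsAbGroupTable G

  tableGroup : Group 0ℓ 0ℓ
  tableGroup = record
    { _≈_     = _≡_
    ; _∙_     = A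
    ; ε       = 0
    ; _⁻¹     = inv
    ; isGroup = record
      { isMonoid = record
        { isSemigroup = record
          { isMagma = record { isEquivalence = isEquivalence ; ∙-cong = cong₂ A }
          ; assoc   = assoc
          }
        ; identity = idˡ , idʳ
        }
      ; inverse = invˡ , invʳ
      ; ⁻¹-cong = cong inv
      }
    }

  prodUpTo-vanishing : ∀ f k → (∀ n → n < k → f n ≡ 0ℤ) → prodUpTo A G f k ≡ 0
  prodUpTo-vanishing f zero    _      = refl
  prodUpTo-vanishing f (suc k) f≡0
    rewrite f≡0 k ≤-refl
          | prodUpTo-vanishing f k (λ n n<k → f≡0 n (≤-trans n<k (n≤1+n k)))
          = idʳ 0

  prodZN-e₋e : ∀ k → prodZN A G (e₋e k) ≡ A k (inv (suc k))
  prodZN-e₋e k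
    rewrite unitDifference-at k
          | unitDifference-next k
          | prodUpTo-vanishing (unitDifference k) k (unitDifference-below k)
          = cong₂ A (trans (idˡ _) (idʳ k)) (idʳ _)

  e₋e∉Φ : ∀ k → Φ A G (e₋e k) ≡ false
  e₋e∉Φ k = trans (isYes≗does _) (dec-false (prodZN A G (e₋e k) ≟ 0) (<⇒≢ (n<1+n k) ∘ k≡1+k))
    where
    open GroupProperties tableGroup using (x∙y⁻¹≈ε⇒x≈y)
    k≡1+k : prodZN A G (e₋e k) ≡ 0 → k ≡ suc k
    k≡1+k e∈Φ = x∙y⁻¹≈ε⇒x≈y k (suc k) (trans (sym (prodZN-e₋e k)) e∈Φ)

proposition4p20 : NowhereDenseΦ
proposition4p20 U (S , S-subgroup , S∈U) =
  V , (S′ , truncatePreimage-isSubgroup S-subgroup B , e₋e∈S′ ∷ S′∈U) , V⊆U , Φ∉V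
  where
  B : ℕ
  B = boundO U

  V : BasicOpen
  V = (e₋e B , true) ∷ U

  S′ : ZN → Bool
  S′ = truncatePreimage B S

  e₋e∈S′ : S′ (e₋e B) ≡ true
  e₋e∈S′ = trans (IsSubgroup.resp S-subgroup _ _ (truncate-e₋e B)) (IsSubgroup.has0 S-subgroup)

  S′∈U : S′ ∈O U
  S′∈U = ∈O-truncatePreimage S-subgroup U ≤-refl S∈U

  V⊆U : ∀ T → IsSubgroup T → T ∈O V → T ∈O U
  V⊆U _ _ (_ ∷ T∈U) = T∈U

  Φ∉V : ∀ A G → ¬ (Φ A G ∈O V)
  Φ∉V A G (e₋e∈Φ ∷ _) with () ← trans (sym e₋e∈Φ) (e₋e∉Φ A G B)
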